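{- Let $(a_n)_{n\ge 1}$ and $(b_n)_{n\ge 1}$ be sequences of complex numbers, and let $(y_n)_{n\ge -1}$ be the sequence determined by given initial values $y_{ -1},y_0\in\mathbb{C}$ and the homogeneous equation $$y_n-b_n y_{n-1}-a_n y_{n-2}=0,\qquad n\ge 1.$$ Assume that there exist sequences $(c_n)_{n\ge 1}$ and $(d_n)_{n\ge 1}$ of complex numbers satisfying $c_n+d_{n+1}=b_n$ and $c_n d_n=-a_n$ for every $n\ge 1$. Then for every $n\ge 1$, $$y_{n}=(y_0-d_1 y_{ -1})\sum_{i=1}^{n+1}\prod_{j=1}^{i-1} c_j \prod_{j=i+1}^{n+1} d_j +y_{ -1}\prod_{j=1}^{n+1} d_j .$$
   Context: Empty products are $1$. -}

module Defs where

open import Level using (Level)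
open import Data.Nat using (ℕ; zero; suc; _∸_)
open import Algebra.Bundles using (CommutativeRing)

module _ {c ℓ : Level} (R : CommutativeRing c ℓ) where
  open CommutativeRing R

  prodFrom : (ℕ → Carrier) → ℕ → ℕ → Carrier
  prodFrom f s zero    = 1#
  prodFrom f s (suc l) = f s * prodFrom f (suc s) l

  sumFrom : (ℕ → Carrier) → ℕ → ℕ → Carrier
  sumFrom f s zero    = 0#
  sumFrom f s (suc l) = f s + sumFrom f (suc s) l

  -- ∏_{j=lo}^{hi} f j  (empty, i.e. 1#, when hi < lo)
  prodRange : (ℕ → Carrier) → ℕ → ℕ → Carrier
  prodRange f lo hi = prodFrom f lo (suc hi ∸ lo)

  -- ∑_{i=lo}^{hi} f i  (empty, i.e. 0#, when hi < lo)
  sumRange : (ℕ → Carrier) → ℕ → ℕ → Carrier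
  sumRange f lo hi = sumFrom f lo (suc hi ∸ lo)

-- With b = c + d′ and a = -(c d) the operator y ↦ yₙ - bₙ yₙ₋₁ - aₙ yₙ₋₂ factors into two
-- first-order ones: the defect zₙ = yₙ - dₙ₊₁ yₙ₋₁ satisfies zₙ = cₙ zₙ₋₁, so
-- zₙ = c₁ ⋯ cₙ z₀.  Solving the first-order recurrence yₙ = dₙ₊₁ yₙ₋₁ + zₙ by variation
-- of constants gives the stated closed form.
module Submission where

open import Defs
open import Level using (Level)
open import Data.Nat using (ℕ; zero; suc; _∸_; _≤_; _<_; z<s) renaming (_+_ to _+ℕ_)
open import Data.Nat.Properties using (+-suc; +-∸-assoc; m+[n∸m]≡n; n∸n≡0; m<m+n; <⇒≤; ≤-refl)
  renaming (+-identityʳ to ℕ-+-identityʳ)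
open import Algebra.Bundles using (CommutativeRing)
import Algebra.Properties.Group as GroupProperties
import Algebra.Solver.Ring.NaturalCoefficients.Default as SemiringSolver
import Relation.Binary.Reasoning.Setoid as SetoidReasoning
import Relation.Binary.PropositionalEquality as ≡

module _ {ℓ₁ ℓ₂ : Level} (R : CommutativeRing ℓ₁ ℓ₂) where
  open CommutativeRing R
  open GroupProperties +-group using (x∙y⁻¹≈ε⇒x≈y; //-rightDividesˡ)
  open SemiringSolver commutativeSemiring using (solve; _:=_; _:+_; _:*_)
  open SetoidReasoning setoid

  prodFrom-snoc : ∀ f s l → prodFrom R f s (suc l) ≈ prodFrom R f s l * f (s +ℕ l)
  prodFrom-snoc f s zero = begin
    f s * 1#        ≈⟨ *-comm _ _ ⟩
    1# * f s        ≡⟨ ≡.cong (λ k → 1# * f k) (≡.sym (ℕ-+-identityʳ s)) ⟩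
    1# * f (s +ℕ 0) ∎
  prodFrom-snoc f s (suc l) = begin
    f s * prodFrom R f (suc s) (suc l)            ≈⟨ *-congˡ (prodFrom-snoc f (suc s) l) ⟩
    f s * (prodFrom R f (suc s) l * f (suc s +ℕ l)) ≈⟨ *-assoc _ _ _ ⟨
    prodFrom R f s (suc l) * f (suc s +ℕ l)       ≡⟨ ≡.cong (λ k → prodFrom R f s (suc l) * f k) (≡.sym (+-suc s l)) ⟩
    prodFrom R f s (suc l) * f (s +ℕ suc l)       ∎

  sumFrom-snoc : ∀ f s l → sumFrom R f s (suc l) ≈ sumFrom R f s l + f (s +ℕ l)
  sumFrom-snoc f s zero = begin
    f s + 0#        ≈⟨ +-comm _ _ ⟩
    0# + f s        ≡⟨ ≡.cong (λ k → 0# + f k) (≡.sym (ℕ-+-identityʳ s)) ⟩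
    0# + f (s +ℕ 0) ∎
  sumFrom-snoc f s (suc l) = begin
    f s + sumFrom R f (suc s) (suc l)             ≈⟨ +-congˡ (sumFrom-snoc f (suc s) l) ⟩
    f s + (sumFrom R f (suc s) l + f (suc s +ℕ l)) ≈⟨ +-assoc _ _ _ ⟨
    sumFrom R f s (suc l) + f (suc s +ℕ l)        ≡⟨ ≡.cong (λ k → sumFrom R f s (suc l) + f k) (≡.sym (+-suc s l)) ⟩
    sumFrom R f s (suc l) + f (s +ℕ suc l)        ∎

  sumFrom-cong : ∀ {f g} s l → (∀ i → s ≤ i → i < s +ℕ l → f i ≈ g i) →
                 sumFrom R f s l ≈ sumFrom R g s l
  sumFrom-cong         s zero    f≈g = refl
  sumFrom-cong {f} {g} s (suc l) f≈g = +-cong (f≈g s ≤-refl (m<m+n s z<s)) (sumFrom-cong (suc s) l f≈g′)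
    where
    f≈g′ : ∀ i → suc s ≤ i → i < suc s +ℕ l → f i ≈ g i
    f≈g′ i s<i i<1+s+l = f≈g i (<⇒≤ s<i) (≡.subst (i <_) (≡.sym (+-suc s l)) i<1+s+l)

  sumFrom-*ˡ : ∀ f x s l → sumFrom R (λ i → x * f i) s l ≈ x * sumFrom R f s l
  sumFrom-*ˡ f x s zero    = sym (zeroʳ x)
  sumFrom-*ˡ f x s (suc l) = trans (+-congˡ (sumFrom-*ˡ f x (suc s) l)) (sym (distribˡ x _ _))

  sumFrom-*ʳ : ∀ f x s l → sumFrom R (λ i → f i * x) s l ≈ sumFrom R f s l * x
  sumFrom-*ʳ f x s zero    = sym (zeroˡ x)
  sumFrom-*ʳ f x s (suc l) = trans (+-congˡ (sumFrom-*ʳ f x (suc s) l)) (sym (distribʳ x _ _))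

  prodRange-snoc : ∀ f {lo hi} → lo ≤ suc hi → prodRange R f lo (suc hi) ≈ prodRange R f lo hi * f (suc hi)
  prodRange-snoc f {lo} {hi} lo≤1+hi = begin
    prodFrom R f lo (suc (suc hi) ∸ lo)          ≡⟨ ≡.cong (prodFrom R f lo) (+-∸-assoc 1 lo≤1+hi) ⟩
    prodFrom R f lo (suc (suc hi ∸ lo))          ≈⟨ prodFrom-snoc f lo (suc hi ∸ lo) ⟩
    prodRange R f lo hi * f (lo +ℕ (suc hi ∸ lo)) ≡⟨ ≡.cong (λ k → prodRange R f lo hi * f k) (m+[n∸m]≡n lo≤1+hi) ⟩
    prodRange R f lo hi * f (suc hi)             ∎

  prodRange-empty : ∀ f n → prodRange R f (suc n) n ≈ 1#
  prodRange-empty f n = reflexive (≡.cong (prodFrom R f (suc n)) (n∸n≡0 n))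

  x-y-z≈0⇒x≈y+z : ∀ {x y z} → x - y - z ≈ 0# → x ≈ y + z
  x-y-z≈0⇒x≈y+z {x} {y} {z} x-y-z≈0 = begin
    x           ≈⟨ //-rightDividesˡ y x ⟨
    (x - y) + y ≈⟨ +-congʳ (x∙y⁻¹≈ε⇒x≈y _ z x-y-z≈0) ⟩
    z + y       ≈⟨ +-comm z y ⟩
    y + z       ∎

  x≈y+[x-y] : ∀ x y → x ≈ y + (x - y)
  x≈y+[x-y] x y = trans (sym (//-rightDividesˡ y x)) (+-comm _ _)

  firstOrder-closedForm : (d e y : ℕ → Carrier) →
    (∀ m → y (suc m) ≈ d (suc m) * y m + e (suc m)) →
    ∀ m → y m ≈ sumRange R (λ i → e i * prodRange R d (suc i) m) 1 m + y 0 * prodRange R d 1 m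
  firstOrder-closedForm d e y step = closedForm
    where
    S D : ℕ → Carrier
    S m = sumRange R (λ i → e i * prodRange R d (suc i) m) 1 m
    D m = prodRange R d 1 m

    S-step : ∀ m → S (suc m) ≈ S m * d (suc m) + e (suc m)
    S-step m = begin
      S (suc m)
        ≈⟨ sumFrom-snoc _ 1 m ⟩
      sumFrom R (λ i → e i * prodRange R d (suc i) (suc m)) 1 m + e (suc m) * prodRange R d (suc (suc m)) (suc m)
        ≈⟨ +-cong (sumFrom-cong 1 m λ i _ i<1+m → trans (*-congˡ (prodRange-snoc d i<1+m)) (sym (*-assoc _ _ _)))
                  (*-congˡ (prodRange-empty d (suc m))) ⟩
      sumFrom R (λ i → e i * prodRange R d (suc i) m * d (suc m)) 1 m + e (suc m) * 1#
        ≈⟨ +-cong (sumFrom-*ʳ _ (d (suc m)) 1 m) (*-identityʳ _) ⟩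
      S m * d (suc m) + e (suc m) ∎

    closedForm : ∀ m → y m ≈ S m + y 0 * D m
    closedForm zero = sym (trans (+-identityˡ _) (*-identityʳ _))
    closedForm (suc m) = begin
      y (suc m)                                 ≈⟨ step m ⟩
      d (suc m) * y m + e (suc m)               ≈⟨ +-congʳ (*-congˡ (closedForm m)) ⟩
      d (suc m) * (S m + y 0 * D m) + e (suc m)
        ≈⟨ solve 5 (λ dₘ sₘ y₀ Dₘ eₘ → dₘ :* (sₘ :+ y₀ :* Dₘ) :+ eₘ := (sₘ :* dₘ :+ eₘ) :+ y₀ :* (Dₘ :* dₘ))
                 refl (d (suc m)) (S m) (y 0) (D m) (e (suc m)) ⟩
      (S m * d (suc m) + e (suc m)) + y 0 * (D m * d (suc m))
        ≈⟨ +-cong (S-step m) (*-congˡ (prodFrom-snoc d 1 m)) ⟨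
      S (suc m) + y 0 * D (suc m) ∎

  factorisation-step : ∀ {a b c d d′ y₀ y₁ y₂ w} →
    y₂ - b * y₁ - a * y₀ ≈ 0# → c + d′ ≈ b → c * d ≈ - a →
    y₁ ≈ d * y₀ + w → y₂ ≈ d′ * y₁ + c * w
  factorisation-step {a} {b} {c} {d} {d′} {y₀} {y₁} {y₂} {w} recurrence c+d′≈b cd≈-a y₁≈dy₀+w = begin
    y₂                                      ≈⟨ x-y-z≈0⇒x≈y+z recurrence ⟩
    b * y₁ + a * y₀                         ≈⟨ +-congʳ (*-congʳ c+d′≈b) ⟨
    (c + d′) * y₁ + a * y₀                  ≈⟨ solve 5 (λ c d′ y₁ a y₀ → (c :+ d′) :* y₁ :+ a :* y₀ := d′ :* y₁ :+ (c :* y₁ :+ a :* y₀))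
                                                     refl c d′ y₁ a y₀ ⟩
    d′ * y₁ + (c * y₁ + a * y₀)             ≈⟨ +-congˡ (+-congʳ (*-congˡ y₁≈dy₀+w)) ⟩
    d′ * y₁ + (c * (d * y₀ + w) + a * y₀)   ≈⟨ +-congˡ (solve 5 (λ c d y₀ w a → c :* (d :* y₀ :+ w) :+ a :* y₀ := c :* w :+ (c :* d :+ a) :* y₀)
                                                     refl c d y₀ w a) ⟩
    d′ * y₁ + (c * w + (c * d + a) * y₀)    ≈⟨ +-congˡ (+-congˡ (*-congʳ (trans (+-congʳ cd≈-a) (-‿inverseˡ a)))) ⟩
    d′ * y₁ + (c * w + 0# * y₀)             ≈⟨ +-congˡ (trans (+-congˡ (zeroˡ y₀)) (+-identityʳ _)) ⟩
    d′ * y₁ + c * w                         ∎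

  secondOrder⇒firstOrder : (a b c d y : ℕ → Carrier) →
    (∀ n → y (suc (suc n)) - b (suc n) * y (suc n) - a (suc n) * y n ≈ 0#) →
    (∀ n → c (suc n) + d (suc (suc n)) ≈ b (suc n)) →
    (∀ n → c (suc n) * d (suc n) ≈ - a (suc n)) →
    ∀ m → y (suc m) ≈ d (suc m) * y m + (y 1 - d 1 * y 0) * prodFrom R c 1 m
  secondOrder⇒firstOrder a b c d y recurrence c+d′≈b cd≈-a = go
    where
    z₀ : Carrier
    z₀ = y 1 - d 1 * y 0
    go : ∀ m → y (suc m) ≈ d (suc m) * y m + z₀ * prodFrom R c 1 m
    go zero    = trans (x≈y+[x-y] (y 1) (d 1 * y 0)) (+-congˡ (sym (*-identityʳ z₀)))
    go (suc m) = begin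
      y (suc (suc m))                                      ≈⟨ factorisation-step (recurrence m) (c+d′≈b m) (cd≈-a m) (go m) ⟩
      d (suc (suc m)) * y (suc m) + c (suc m) * (z₀ * prodFrom R c 1 m)
        ≈⟨ +-congˡ (solve 3 (λ cₘ z C → cₘ :* (z :* C) := z :* (C :* cₘ)) refl (c (suc m)) z₀ (prodFrom R c 1 m)) ⟩
      d (suc (suc m)) * y (suc m) + z₀ * (prodFrom R c 1 m * c (suc m))
        ≈⟨ +-congˡ (*-congˡ (prodFrom-snoc c 1 m)) ⟨
      d (suc (suc m)) * y (suc m) + z₀ * prodFrom R c 1 (suc m) ∎

theorem1p2 : {ℓ₁ ℓ₂ : Level} (R : CommutativeRing ℓ₁ ℓ₂) →
    let open CommutativeRing R in
    (a b c d Y : ℕ → Carrier) →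
    (∀ n → Y (suc (suc n)) - b (suc n) * Y (suc n) - a (suc n) * Y n ≈ 0#) →
    (∀ n → c (suc n) + d (suc (suc n)) ≈ b (suc n)) →
    (∀ n → c (suc n) * d (suc n) ≈ - a (suc n)) →
    ∀ n → Y (suc (suc n)) ≈
      (Y 1 - d 1 * Y 0)
        * sumRange R (λ i → prodRange R c 1 (i ∸ 1) * prodRange R d (suc i) (suc (suc n))) 1 (suc (suc n))
      + Y 0 * prodRange R d 1 (suc (suc n))
theorem1p2 R a b c d Y recurrence c+d′≈b cd≈-a n = begin
  -- C (suc m) reduces to prodFrom R c 1 m, so the forcing term is z₀ * C i.
  Y N
    ≈⟨ firstOrder-closedForm R d (λ i → z₀ * C i) Y (secondOrder⇒firstOrder R a b c d Y recurrence c+d′≈b cd≈-a) N ⟩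
  sumRange R (λ i → z₀ * C i * D i) 1 N + Y 0 * prodRange R d 1 N
    ≈⟨ +-congʳ (sumFrom-cong R 1 N λ i _ _ → *-assoc z₀ (C i) (D i)) ⟩
  sumRange R (λ i → z₀ * (C i * D i)) 1 N + Y 0 * prodRange R d 1 N
    ≈⟨ +-congʳ (sumFrom-*ˡ R (λ i → C i * D i) z₀ 1 N) ⟩
  z₀ * sumRange R (λ i → C i * D i) 1 N + Y 0 * prodRange R d 1 N ∎
  where
  open CommutativeRing R
  open SetoidReasoning setoid
  N : ℕ
  N = suc (suc n)
  z₀ : Carrier
  z₀ = Y 1 - d 1 * Y 0
  C D : ℕ → Carrier
  C i = prodRange R c 1 (i ∸ 1)
  D i = prodRange R d (suc i) N
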